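{- Let $q=3^s$ and $f(X)=X^3-a_2X^2-a_1X-a_0\in\mathbb{F}_q[X]$. Then $f$ is irreducible over $\mathbb{F}_q$ if and only if (1) in the case $a_2=0$ and $a_1\neq 0$: there is $b\in\mathbb{F}_q$ with $a_1=b^2$ and $\mathrm{Tr}_{q|3}(a_0/b^3)\neq 0$; (2) in the case $a_2\neq 0$: there is $b\in\mathbb{F}_q$ with $a_2^4/(a_2^2a_1^2+a_1^3-a_0a_2^3)=b^2$ and $\mathrm{Tr}_{q|3}(1/(a_2b))\neq 0$.
   Context: $\mathrm{Tr}_{q|3}$ denotes the trace map from $\mathbb{F}_q$ to $\mathbb{F}_3$. -}

module Defs where

open import Level using (Level; _⊔_) renaming (suc to lsuc)
open import Algebra.Bundles using (CommutativeRing)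
open import Data.Nat using (ℕ; zero; suc; _∸_; _≤_; _^_)
open import Data.Fin using (Fin)
open import Data.Product using (Σ; _×_; ∃)
open import Relation.Nullary using (¬_)
open import Function.Bundles using (Bijection)
import Relation.Binary.PropositionalEquality as PE

-- A finite field with exactly q elements: a commutative ring, 0 ≉ 1, with
-- a total inverse map (convention 0⁻¹ = 0, i.e. x⁻¹ = x^(q-2)) that is a
-- genuine inverse on nonzero elements, and whose carrier (up to ≈) is in
-- bijection with Fin q.
record FiniteField (c ℓ : Level) (q : ℕ) : Set (lsuc (c ⊔ ℓ)) where
  field
    commRing : CommutativeRing c ℓ
  open CommutativeRing commRing public
  field
    _⁻¹        : Carrier → Carrier
    ⁻¹-cong    : ∀ {x y} → x ≈ y → x ⁻¹ ≈ y ⁻¹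
    0≉1        : ¬ (0# ≈ 1#)
    inverseʳ   : ∀ x → ¬ (x ≈ 0#) → (x * (x ⁻¹)) ≈ 1#
    0⁻¹≈0      : (0# ⁻¹) ≈ 0#
    card       : Bijection setoid (PE.setoid (Fin q))

  infix 8 _⁻¹

  -- division with the convention x / 0 = 0
  _/_ : Carrier → Carrier → Carrier
  x / y = x * (y ⁻¹)

  _^′_ : Carrier → ℕ → Carrier
  x ^′ zero  = 1#
  x ^′ suc n = x * (x ^′ n)

  Σ< : ℕ → (ℕ → Carrier) → Carrier
  Σ< zero    g = 0#
  Σ< (suc n) g = Σ< n g + g n

  Tr : ℕ → Carrier → Carrier
  Tr s x = Σ< s (λ i → x ^′ (3 ^ i))

  -- Polynomials over the field: coefficient functions ℕ → Carrier
  -- (coefficient of X^i at index i).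
  Poly : Set c
  Poly = ℕ → Carrier

  HasDegree : Poly → ℕ → Set ℓ
  HasDegree g d = ¬ (g d ≈ 0#) × (∀ i → d Data.Nat.< i → g i ≈ 0#)

  _·_ : Poly → Poly → Poly
  (g · h) k = Σ< (suc k) (λ i → g i * h (k ∸ i))

  -- a polynomial p of positive degree is irreducible iff it is not a product
  -- of two polynomials of positive degree (over a field, the non-units among
  -- nonzero polynomials are exactly those of positive degree)
  Irreducible : Poly → Set (c ⊔ ℓ)
  Irreducible p =
    ¬ (Σ Poly λ g → Σ Poly λ h → Σ ℕ λ dg → Σ ℕ λ dh →
         1 ≤ dg × 1 ≤ dh × HasDegree g dg × HasDegree h dh ×
         (∀ k → (g · h) k ≈ p k))

  cubic : Carrier → Carrier → Carrier → Poly
  cubic a₂ a₁ a₀ 0 = - a₀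
  cubic a₂ a₁ a₀ 1 = - a₁
  cubic a₂ a₁ a₀ 2 = - a₂
  cubic a₂ a₁ a₀ 3 = 1#
  cubic a₂ a₁ a₀ (suc (suc (suc (suc _)))) = 0#

module Submission where

-- A cubic over a field is irreducible iff it has no root, so everything is
-- about roots.  Write σ x = x³ (the Frobenius map) and Tr = Σ_{i<s} σⁱ.
-- * Depressed cubics X³ - A₁X - A₀, A₁ ≠ 0.  In characteristic 3 the map
--   φ x = σ x - A₁x is additive.  If A₁ = b², then X = bY turns f = 0 into the
--   Artin–Schreier equation σ Y - Y = A₀/b³, solvable iff Tr(A₀/b³) = 0
--   (additive Hilbert 90).  If A₁ is not a square, φ is injective, hence
--   bijective on the finite field, and f has a root.
-- * General cubics, a₂ ≠ 0.  With v = a₁/a₂ and X = v + 1/Z one gets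
--   f(v + d) = σ d · f(v) · (σ Z - B₁Z - B₀) for Z d = 1, where
--   B₁ = a₂/f(v), B₀ = -1/f(v), and f(v)a₂³ is the denominator D of the
--   statement; so the first case applies with B₁ = a₂⁴/D and
--   B₀/b³ = -1/(a₂b).

open import Defs
open import Level using (Level; _⊔_)
open import Data.Nat as ℕ using (ℕ; zero; suc; _^_; z≤n; s≤s)
import Data.Nat.Properties as ℕP
open import Data.Fin as Fin using (Fin; zero; suc; punchIn)
import Data.Fin.Properties as FinP
open import Data.Fin.Permutation using (Permutation; permutation)
open import Data.Product using (Σ; _×_; _,_; proj₁; proj₂)
open import Data.Sum using (_⊎_; inj₁; inj₂)
open import Data.Empty using (⊥-elim)
open import Data.Maybe using (Maybe; just; nothing)
open import Data.List using (List; []; _∷_; _++_; length; replicate)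
import Data.List.Properties as ListP
open import Relation.Nullary using (¬_; Dec; yes; no; ¬?)
open import Relation.Binary.Definitions using (tri<; tri≈; tri>)
open import Relation.Binary.PropositionalEquality as PE using (_≡_; _≢_)
import Relation.Binary.Reasoning.Setoid as SetoidReasoning
open import Function.Bundles using (Bijection)
open import Algebra.Bundles using (CommutativeMonoid)
open import Algebra.Bundles.Raw using (RawRing)
import Algebra.Properties.CommutativeMonoid.Sum as CMSum
import Algebra.Solver.Ring.AlmostCommutativeRing as ACR
import Algebra.Solver.Ring as RingSolver

injective⇒surjective : ∀ {n} (f : Fin n → Fin n) → (∀ {i j} → f i ≡ f j → i ≡ j) →
  ∀ y → Σ (Fin n) λ i → f i ≡ y
injective⇒surjective {suc m} f inj y with FinP.any? (λ i → f i Fin.≟ y)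
... | yes hit = hit
... | no miss = ⊥-elim (ℕP.1+n≰n (FinP.injective⇒≤ punchOut-injective))
  where
  avoids : ∀ i → y ≢ f i
  avoids i y≡fi = miss (i , PE.sym y≡fi)
  -- f misses y, so it factors injectively through Fin m
  punchOut-injective : ∀ {i j} → Fin.punchOut (avoids i) ≡ Fin.punchOut (avoids j) → i ≡ j
  punchOut-injective eq = inj (FinP.punchOut-injective (avoids _) (avoids _) eq)

module SumFacts {a l} (M : CommutativeMonoid a l) where
  open CommutativeMonoid M
  open CMSum M public using (sum; sum-cong-≋; sum-permute; ∑-distrib-+; sum-replicate)
  open CMSum M using (sum-remove; sum-replicate-zero)
  open SetoidReasoning setoid

  sum-single : ∀ {n} (f : Fin n → Carrier) (i₀ : Fin n) →
    (∀ j → j ≢ i₀ → f j ≈ ε) → sum f ≈ f i₀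
  sum-single {suc n} f i₀ vanish = begin
    sum f                                ≈⟨ sum-remove {i = i₀} f ⟩
    f i₀ ∙ sum (λ k → f (punchIn i₀ k))  ≈⟨ ∙-congˡ rest≈ε ⟩
    f i₀ ∙ ε                             ≈⟨ identityʳ _ ⟩
    f i₀                                 ∎
    where
    rest≈ε : sum (λ k → f (punchIn i₀ k)) ≈ ε
    rest≈ε = trans (sum-cong-≋ (λ k → vanish _ (FinP.punchInᵢ≢i i₀ k))) (sum-replicate-zero n)

-- The prime field 𝔽₃.  It serves as coefficient ring of the ring solver, so
-- that identities valid only in characteristic 3, such as (x + y)³ = x³ + y³,
-- are normalised automatically.
data 𝔽₃ : Set where
  0₃ 1₃ 2₃ : 𝔽₃

_+₃_ : 𝔽₃ → 𝔽₃ → 𝔽₃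
0₃ +₃ y  = y
1₃ +₃ 0₃ = 1₃
1₃ +₃ 1₃ = 2₃
1₃ +₃ 2₃ = 0₃
2₃ +₃ 0₃ = 2₃
2₃ +₃ 1₃ = 0₃
2₃ +₃ 2₃ = 1₃

_*₃_ : 𝔽₃ → 𝔽₃ → 𝔽₃
0₃ *₃ y  = 0₃
1₃ *₃ y  = y
2₃ *₃ 0₃ = 0₃
2₃ *₃ 1₃ = 2₃
2₃ *₃ 2₃ = 1₃

-₃_ : 𝔽₃ → 𝔽₃
-₃ 0₃ = 0₃
-₃ 1₃ = 2₃
-₃ 2₃ = 1₃

𝔽₃-rawRing : RawRing _ _
𝔽₃-rawRing = record
  { Carrier = 𝔽₃ ; _≈_ = _≡_ ; _+_ = _+₃_ ; _*_ = _*₃_ ; -_ = -₃_ ; 0# = 0₃ ; 1# = 1₃ }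

_≟₃_ : (x y : 𝔽₃) → Maybe (x ≡ y)
0₃ ≟₃ 0₃ = just PE.refl
1₃ ≟₃ 1₃ = just PE.refl
2₃ ≟₃ 2₃ = just PE.refl
_  ≟₃ _  = nothing

module FiniteFieldFacts {c ℓ} {q : ℕ} (F : FiniteField c ℓ q) where
  open FiniteField F hiding (zero)
  open SetoidReasoning setoid
  open import Algebra.Properties.Ring ring public
    using (-0#≈0#; -‿involutive; -‿+-comm; +-inverseˡ-unique; +-inverseʳ-unique;
           +-identityʳ-unique; x∙y⁻¹≈ε⇒x≈y; x≈y⇒x∙y⁻¹≈ε)
  open import Algebra.Properties.Semiring.Exp semiring using (^-assocʳ)
    renaming (_^_ to _^ᴸ_)
  open import Algebra.Properties.CommutativeSemiring.Exp commutativeSemiring using (^-distrib-*)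
  import Algebra.Properties.Semiring.Mult semiring as Mult
  open import Algebra.Properties.CommutativeSemigroup +-commutativeSemigroup using (interchange)

  open Bijection card public using ()
    renaming (to to index; cong to index-cong; injective to index-injective)
  open Bijection card using (strictlySurjective)

  elem : Fin q → Carrier
  elem i = proj₁ (strictlySurjective i)

  index-elem : ∀ i → index (elem i) ≡ i
  index-elem i = proj₂ (strictlySurjective i)

  elem-injective : ∀ {i j} → elem i ≈ elem j → i ≡ j
  elem-injective {i} {j} p = PE.trans (PE.sym (index-elem i)) (PE.trans (index-cong p) (index-elem j))

  elem-index : ∀ x → elem (index x) ≈ x
  elem-index x = index-injective (index-elem (index x))

  _≈?_ : ∀ x y → Dec (x ≈ y)
  x ≈? y with index x Fin.≟ index y
  ... | yes p = yes (index-injective p)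
  ... | no ¬p = no (λ x≈y → ¬p (index-cong x≈y))

  2≤q : 2 ℕ.≤ q
  2≤q = FinP.injective⇒≤ {f = pick} pick-injective
    where
    pick : Fin 2 → Fin q
    pick zero    = index 0#
    pick (suc _) = index 1#
    pick-injective : ∀ {i j} → pick i ≡ pick j → i ≡ j
    pick-injective {zero}     {zero}     _ = PE.refl
    pick-injective {suc zero} {suc zero} _ = PE.refl
    pick-injective {zero}     {suc zero} p = ⊥-elim (0≉1 (index-injective p))
    pick-injective {suc zero} {zero}     p = ⊥-elim (0≉1 (sym (index-injective p)))

  1≉0 : ¬ (1# ≈ 0#)
  1≉0 p = 0≉1 (sym p)

  inverseˡ : ∀ x → ¬ (x ≈ 0#) → x ⁻¹ * x ≈ 1#
  inverseˡ x x≉0 = trans (*-comm _ _) (inverseʳ x x≉0)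

  nonzero-cancelˡ : ∀ {x y} → ¬ (x ≈ 0#) → x * y ≈ 0# → y ≈ 0#
  nonzero-cancelˡ {x} {y} x≉0 xy≈0 = begin
    y                ≈⟨ sym (*-identityˡ y) ⟩
    1# * y           ≈⟨ *-congʳ (sym (inverseˡ x x≉0)) ⟩
    (x ⁻¹ * x) * y   ≈⟨ *-assoc _ _ _ ⟩
    x ⁻¹ * (x * y)   ≈⟨ *-congˡ xy≈0 ⟩
    x ⁻¹ * 0#        ≈⟨ zeroʳ _ ⟩
    0#               ∎

  *-nonzero : ∀ {x y} → ¬ (x ≈ 0#) → ¬ (y ≈ 0#) → ¬ (x * y ≈ 0#)
  *-nonzero x≉0 y≉0 xy≈0 = y≉0 (nonzero-cancelˡ x≉0 xy≈0)

  *-cancelʳ-nonzero : ∀ {x y z} → ¬ (z ≈ 0#) → x * z ≈ y * z → x ≈ y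
  *-cancelʳ-nonzero {x} {y} {z} z≉0 p = begin
    x                ≈⟨ sym (*-identityʳ x) ⟩
    x * 1#           ≈⟨ *-congˡ (sym (inverseʳ z z≉0)) ⟩
    x * (z * z ⁻¹)   ≈⟨ sym (*-assoc _ _ _) ⟩
    (x * z) * z ⁻¹   ≈⟨ *-congʳ p ⟩
    (y * z) * z ⁻¹   ≈⟨ *-assoc _ _ _ ⟩
    y * (z * z ⁻¹)   ≈⟨ *-congˡ (inverseʳ z z≉0) ⟩
    y * 1#           ≈⟨ *-identityʳ y ⟩
    y                ∎

  *-/-cancel : ∀ a {c} → ¬ (c ≈ 0#) → c * (a / c) ≈ a
  *-/-cancel a {c} c≉0 = begin
    c * (a * c ⁻¹)   ≈⟨ sym (*-assoc _ _ _) ⟩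
    (c * a) * c ⁻¹   ≈⟨ *-congʳ (*-comm c a) ⟩
    (a * c) * c ⁻¹   ≈⟨ *-assoc _ _ _ ⟩
    a * (c * c ⁻¹)   ≈⟨ *-congˡ (inverseʳ c c≉0) ⟩
    a * 1#           ≈⟨ *-identityʳ a ⟩
    a                ∎

  ⁻¹-nonzero : ∀ x → ¬ (x ≈ 0#) → ¬ (x ⁻¹ ≈ 0#)
  ⁻¹-nonzero x x≉0 p = 1≉0 (trans (sym (inverseˡ x x≉0)) (trans (*-congʳ p) (zeroˡ x)))

  -‿nonzero : ∀ x → ¬ (x ≈ 0#) → ¬ (- x ≈ 0#)
  -‿nonzero x x≉0 p = x≉0 (trans (sym (-‿involutive x)) (trans (-‿cong p) -0#≈0#))

  ^′≡^ᴸ : ∀ x n → x ^′ n ≡ x ^ᴸ n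
  ^′≡^ᴸ x zero    = PE.refl
  ^′≡^ᴸ x (suc n) = PE.cong (x *_) (^′≡^ᴸ x n)

  ^′-congˡ : ∀ n {x y} → x ≈ y → x ^′ n ≈ y ^′ n
  ^′-congˡ zero    p = refl
  ^′-congˡ (suc n) p = *-cong p (^′-congˡ n p)

  ^′-congʳ : ∀ x {m n} → m ≡ n → x ^′ m ≈ x ^′ n
  ^′-congʳ x PE.refl = refl

  ^′-assocʳ : ∀ x m n → (x ^′ m) ^′ n ≈ x ^′ (m ℕ.* n)
  ^′-assocʳ x m n rewrite ^′≡^ᴸ (x ^′ m) n | ^′≡^ᴸ x m | ^′≡^ᴸ x (m ℕ.* n) = ^-assocʳ x m n

  ^′-distrib-* : ∀ x y n → (x * y) ^′ n ≈ x ^′ n * y ^′ n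
  ^′-distrib-* x y n rewrite ^′≡^ᴸ (x * y) n | ^′≡^ᴸ x n | ^′≡^ᴸ y n = ^-distrib-* x y n

  ^′-nonzero : ∀ n {x} → ¬ (x ≈ 0#) → ¬ (x ^′ n ≈ 0#)
  ^′-nonzero zero    x≉0 = 1≉0
  ^′-nonzero (suc n) x≉0 = *-nonzero x≉0 (^′-nonzero n x≉0)

  ^′≈0⇒≈0 : ∀ n {x} → x ^′ n ≈ 0# → x ≈ 0#
  ^′≈0⇒≈0 n {x} p with x ≈? 0#
  ... | yes x≈0 = x≈0
  ... | no x≉0 = ⊥-elim (^′-nonzero n x≉0 p)

  0^′ : ∀ {n} → 1 ℕ.≤ n → 0# ^′ n ≈ 0#
  0^′ {suc n} _ = zeroˡ _

  ×1-homo-^ : ∀ m n → (m ^ n) Mult.× 1# ≈ (m Mult.× 1#) ^′ n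
  ×1-homo-^ m zero    = +-identityʳ 1#
  ×1-homo-^ m (suc n) = trans (Mult.×1-homo-* m (m ^ n)) (*-congˡ (×1-homo-^ m n))

  module FieldSum {a l} (M : CommutativeMonoid a l) where
    private module M = CommutativeMonoid M
    open SumFacts M

    sum-bijection : (G : Carrier → M.Carrier) → (∀ {x y} → x ≈ y → G x M.≈ G y) →
      (g h : Carrier → Carrier) → (∀ {x y} → x ≈ y → g x ≈ g y) → (∀ {x y} → x ≈ y → h x ≈ h y) →
      (∀ x → g (h x) ≈ x) → (∀ x → h (g x) ≈ x) →
      sum (λ i → G (elem i)) M.≈ sum (λ i → G (g (elem i)))
    sum-bijection G G-cong g h g-cong h-cong gh hg =
      M.trans (sum-permute (λ i → G (elem i)) π) (sum-cong-≋ (λ i → G-cong (elem-index (g (elem i)))))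
      where
      π : Permutation q q
      π = permutation (λ i → index (g (elem i))) (λ j → index (h (elem j)))
            (λ j → PE.trans (index-cong (g-cong (elem-index (h (elem j)))))
                            (PE.trans (index-cong (gh (elem j))) (index-elem j)))
            (λ j → PE.trans (index-cong (h-cong (elem-index (g (elem j)))))
                            (PE.trans (index-cong (hg (elem j))) (index-elem j)))

  module ∑ = SumFacts +-commutativeMonoid
  module ∏ = SumFacts *-commutativeMonoid

  -- q · 1 = 0: the sums of x and of x + 1 over all field elements agree.
  q×1≈0 : q Mult.× 1# ≈ 0#
  q×1≈0 = +-identityʳ-unique (∑.sum elem) (q Mult.× 1#) (sym (begin
    ∑.sum elem                              ≈⟨ FieldSum.sum-bijection +-commutativeMonoid (λ x → x) (λ p → p)
                                                 (_+ 1#) (_- 1#) +-congʳ +-congʳ (shift (-‿inverseʳ 1#)) (shift (-‿inverseˡ 1#)) ⟩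
    ∑.sum (λ i → elem i + 1#)               ≈⟨ ∑.∑-distrib-+ elem (λ _ → 1#) ⟩
    ∑.sum elem + ∑.sum (λ (_ : Fin q) → 1#) ≈⟨ +-congˡ (∑.sum-replicate q) ⟩
    ∑.sum elem + q Mult.× 1#                ∎))
    where
    shift : ∀ {u v} → v + u ≈ 0# → ∀ x → (x + u) + v ≈ x
    shift {u} {v} vu x = trans (+-assoc _ _ _) (trans (+-congˡ (trans (+-comm u v) vu)) (+-identityʳ x))

  ifZero : Carrier → Carrier → Carrier → Carrier
  ifZero x a b with x ≈? 0#
  ... | yes _ = a
  ... | no _  = b

  ifZero-yes : ∀ {x} a b → x ≈ 0# → ifZero x a b ≈ a
  ifZero-yes {x} a b x≈0 with x ≈? 0#
  ... | yes _  = refl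
  ... | no x≉0 = ⊥-elim (x≉0 x≈0)

  ifZero-no : ∀ {x} a b → ¬ (x ≈ 0#) → ifZero x a b ≈ b
  ifZero-no {x} a b x≉0 with x ≈? 0#
  ... | yes x≈0 = ⊥-elim (x≉0 x≈0)
  ... | no _    = refl

  ifZero-cong : ∀ {x y} a {b b′} → x ≈ y → b ≈ b′ → ifZero x a b ≈ ifZero y a b′
  ifZero-cong {x} {y} a {b} {b′} x≈y b≈b′ with x ≈? 0#
  ... | yes x≈0 = sym (ifZero-yes a b′ (trans (sym x≈y) x≈0))
  ... | no x≉0  = trans b≈b′ (sym (ifZero-no a b′ (λ y≈0 → x≉0 (trans x≈y y≈0))))

  ∏-nonzero : ∀ {n} (f : Fin n → Carrier) → (∀ i → ¬ (f i ≈ 0#)) → ¬ (∏.sum f ≈ 0#)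
  ∏-nonzero {zero}  f nz = 1≉0
  ∏-nonzero {suc n} f nz = *-nonzero (nz zero) (∏-nonzero (λ i → f (suc i)) (λ i → nz (suc i)))

  ∏-const : ∀ n a → ∏.sum {n} (λ _ → a) ≈ a ^′ n
  ∏-const n a = trans (∏.sum-replicate n) (reflexive (PE.sym (^′≡^ᴸ a n)))

  ∏-zero-slot : ∀ a → ∏.sum (λ i → ifZero (elem i) a 1#) ≈ a
  ∏-zero-slot a = trans (∏.sum-single _ (index 0#) off-zero) (ifZero-yes a 1# (elem-index 0#))
    where
    off-zero : ∀ j → j ≢ index 0# → ifZero (elem j) a 1# ≈ 1#
    off-zero j j≢0 = ifZero-no a 1# (λ ej≈0 → j≢0 (elem-injective (trans ej≈0 (sym (elem-index 0#)))))

  -- For a ≠ 0 the product of a over the nonzero slots, i.e. a^(q-1), is 1: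
  -- x ↦ a x permutes the field, so ∏ u (a x) = ∏ u x for u x = ifZero x 1 x,
  -- while u (a x) = ifZero x 1 a · u x.
  ∏-nonzero-slots : ∀ a → ¬ (a ≈ 0#) → ∏.sum (λ i → ifZero (elem i) 1# a) ≈ 1#
  ∏-nonzero-slots a a≉0 = *-cancelʳ-nonzero (∏-nonzero U (λ i → u-nonzero (elem i))) (begin
    ∏.sum K * ∏.sum U              ≈⟨ sym (∏.∑-distrib-+ K U) ⟩
    ∏.sum (λ i → K i * U i)        ≈⟨ ∏.sum-cong-≋ (λ i → sym (u-scale (elem i))) ⟩
    ∏.sum (λ i → u (a * elem i))   ≈⟨ sym (FieldSum.sum-bijection *-commutativeMonoid u (λ p → ifZero-cong 1# p p)
                                        (a *_) (a ⁻¹ *_) *-congˡ *-congˡ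
                                        (cancel (inverseʳ a a≉0)) (cancel (inverseˡ a a≉0))) ⟩
    ∏.sum U                        ≈⟨ sym (*-identityˡ _) ⟩
    1# * ∏.sum U                   ∎)
    where
    u : Carrier → Carrier
    u x = ifZero x 1# x
    K U : Fin q → Carrier
    K i = ifZero (elem i) 1# a
    U i = u (elem i)
    u-nonzero : ∀ x → ¬ (u x ≈ 0#)
    u-nonzero x with x ≈? 0#
    ... | yes _  = 1≉0
    ... | no x≉0 = x≉0
    u-scale : ∀ x → u (a * x) ≈ ifZero x 1# a * u x
    u-scale x with x ≈? 0#
    ... | yes x≈0 = trans (ifZero-yes 1# _ (trans (*-congˡ x≈0) (zeroʳ a))) (sym (*-identityˡ 1#))
    ... | no x≉0  = ifZero-no 1# _ (*-nonzero a≉0 x≉0)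
    cancel : ∀ {b b′} → b * b′ ≈ 1# → ∀ x → b * (b′ * x) ≈ x
    cancel bb′≈1 x = trans (sym (*-assoc _ _ _)) (trans (*-congʳ bb′≈1) (*-identityˡ x))

  fermat : ∀ a → a ^′ q ≈ a
  fermat a with a ≈? 0#
  ... | yes a≈0 = trans (^′-congˡ q a≈0) (trans (0^′ (ℕP.≤-trans (s≤s z≤n) 2≤q)) (sym a≈0))
  ... | no a≉0  = begin
    a ^′ q                                           ≈⟨ sym (∏-const q a) ⟩
    ∏.sum (λ (_ : Fin q) → a)                        ≈⟨ ∏.sum-cong-≋ (λ i → split (elem i)) ⟩
    ∏.sum (λ i → ifZero (elem i) 1# a * ifZero (elem i) a 1#)
                                                     ≈⟨ ∏.∑-distrib-+ (λ i → ifZero (elem i) 1# a) (λ i → ifZero (elem i) a 1#) ⟩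
    ∏.sum (λ i → ifZero (elem i) 1# a) * ∏.sum (λ i → ifZero (elem i) a 1#)
                                                     ≈⟨ *-cong (∏-nonzero-slots a a≉0) (∏-zero-slot a) ⟩
    1# * a                                           ≈⟨ *-identityˡ a ⟩
    a                                                ∎
    where
    split : ∀ x → a ≈ ifZero x 1# a * ifZero x a 1#
    split x with x ≈? 0#
    ... | yes _ = sym (*-identityˡ a)
    ... | no _  = sym (*-identityʳ a)

  Σ<-cong : ∀ n {g h : ℕ → Carrier} → (∀ i → g i ≈ h i) → Σ< n g ≈ Σ< n h
  Σ<-cong zero    p = refl
  Σ<-cong (suc n) p = +-cong (Σ<-cong n p) (p n)

  Σ<-+ : ∀ n (g h : ℕ → Carrier) → Σ< n (λ i → g i + h i) ≈ Σ< n g + Σ< n h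
  Σ<-+ zero    g h = sym (+-identityˡ _)
  Σ<-+ (suc n) g h = trans (+-congʳ (Σ<-+ n g h)) (interchange _ _ _ _)

  Σ<-*ˡ : ∀ n a (g : ℕ → Carrier) → Σ< n (λ i → a * g i) ≈ a * Σ< n g
  Σ<-*ˡ zero    a g = sym (zeroʳ a)
  Σ<-*ˡ (suc n) a g = trans (+-congʳ (Σ<-*ˡ n a g)) (sym (distribˡ _ _ _))

  Σ<-shift : ∀ n (g : ℕ → Carrier) → Σ< (suc n) g ≈ g 0 + Σ< n (λ i → g (suc i))
  Σ<-shift zero    g = trans (+-identityˡ _) (sym (+-identityʳ _))
  Σ<-shift (suc n) g = trans (+-congʳ (Σ<-shift n g)) (+-assoc _ _ _)

  Σ<-zero : ∀ n (g : ℕ → Carrier) → (∀ i → i ℕ.< n → g i ≈ 0#) → Σ< n g ≈ 0#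
  Σ<-zero zero    g p = refl
  Σ<-zero (suc n) g p = trans (+-cong (Σ<-zero n g (λ i i<n → p i (ℕP.m<n⇒m<1+n i<n))) (p n ℕP.≤-refl))
                              (+-identityʳ 0#)

  Σ<-single : ∀ n (g : ℕ → Carrier) m → m ℕ.< n → (∀ i → i ℕ.< n → i ≢ m → g i ≈ 0#) → Σ< n g ≈ g m
  Σ<-single (suc n) g m m<1+n p with ℕP.m<1+n⇒m<n∨m≡n m<1+n
  ... | inj₁ m<n = trans (+-cong (Σ<-single n g m m<n (λ i i<n → p i (ℕP.m<n⇒m<1+n i<n)))
                                 (p n ℕP.≤-refl (λ n≡m → ℕP.<-irrefl (PE.sym n≡m) m<n)))
                         (+-identityʳ _)
  ... | inj₂ PE.refl = trans (+-congʳ (Σ<-zero n g (λ i i<n → p i (ℕP.m<n⇒m<1+n i<n) (λ i≡m → ℕP.<-irrefl i≡m i<n))))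
                             (+-identityˡ _)

  module ProductDegree (g h : Poly) (dg dh : ℕ)
           (g-vanishes : ∀ i → dg ℕ.< i → g i ≈ 0#) (h-vanishes : ∀ i → dh ℕ.< i → h i ≈ 0#) where

    -- for i < dg the cofactor index k - i exceeds dh once k ≥ dg + dh
    cofactor-bound : ∀ i → i ℕ.< dg → suc dh ℕ.+ i ℕ.≤ dg ℕ.+ dh
    cofactor-bound i i<dg = PE.subst₂ ℕ._≤_ (ℕP.+-suc dh i) (ℕP.+-comm dh dg) (ℕP.+-monoʳ-≤ dh i<dg)

    coefficient-beyond : ∀ k → dg ℕ.+ dh ℕ.< k → (g · h) k ≈ 0#
    coefficient-beyond k lt = Σ<-zero (suc k) _ term
      where
      term : ∀ i → i ℕ.< suc k → g i * h (k ℕ.∸ i) ≈ 0#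
      term i _ with ℕP.<-cmp dg i
      ... | tri< dg<i _ _ = trans (*-congʳ (g-vanishes i dg<i)) (zeroˡ _)
      ... | tri≈ _ PE.refl _ = trans (*-congˡ (h-vanishes _ dh<k-dg)) (zeroʳ _)
        where
        dh<k-dg : dh ℕ.< k ℕ.∸ dg
        dh<k-dg = ℕP.m+n≤o⇒m≤o∸n (suc dh) (PE.subst (ℕ._≤ k) (PE.cong suc (ℕP.+-comm dg dh)) lt)
      ... | tri> _ _ i<dg = trans (*-congˡ (h-vanishes _ dh<k-i)) (zeroʳ _)
        where
        dh<k-i : dh ℕ.< k ℕ.∸ i
        dh<k-i = ℕP.m+n≤o⇒m≤o∸n (suc dh) (ℕP.≤-trans (cofactor-bound i i<dg) (ℕP.≤-trans (ℕP.n≤1+n _) lt))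

    leading-coefficient : (g · h) (dg ℕ.+ dh) ≈ g dg * h dh
    leading-coefficient = trans (Σ<-single (suc (dg ℕ.+ dh)) _ dg (s≤s (ℕP.m≤m+n dg dh)) term)
                                (*-congˡ (reflexive (PE.cong h (ℕP.m+n∸m≡n dg dh))))
      where
      term : ∀ i → i ℕ.< suc (dg ℕ.+ dh) → i ≢ dg → g i * h (dg ℕ.+ dh ℕ.∸ i) ≈ 0#
      term i _ i≢dg with ℕP.<-cmp dg i
      ... | tri< dg<i _ _ = trans (*-congʳ (g-vanishes i dg<i)) (zeroˡ _)
      ... | tri≈ _ dg≡i _ = ⊥-elim (i≢dg (PE.sym dg≡i))
      ... | tri> _ _ i<dg = trans (*-congˡ (h-vanishes _ (ℕP.m+n≤o⇒m≤o∸n (suc dh) (cofactor-bound i i<dg)))) (zeroʳ _)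

module Char3 {c ℓ} (s : ℕ) (F : FiniteField c ℓ (3 ^ s)) where
  open FiniteField F hiding (zero)
  open FiniteFieldFacts F
  open SetoidReasoning setoid
  import Algebra.Properties.Semiring.Mult semiring as Mult
  open import Algebra.Properties.Ring ring using (-‿distribˡ-*; +-cancelˡ)

  -- Characteristic 3: (3 · 1)^s = 3^s · 1 = 0, and a field has no nonzero
  -- nilpotents.
  3×1≈0 : 3 Mult.× 1# ≈ 0#
  3×1≈0 = ^′≈0⇒≈0 s (trans (sym (×1-homo-^ 3 s)) q×1≈0)

  1+1≈-1 : 1# + 1# ≈ - 1#
  1+1≈-1 = +-inverseʳ-unique 1# (1# + 1#) (trans (+-congˡ (+-congˡ (sym (+-identityʳ 1#)))) 3×1≈0)

  ⟦_⟧₃ : 𝔽₃ → Carrier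
  ⟦ 0₃ ⟧₃ = 0#
  ⟦ 1₃ ⟧₃ = 1#
  ⟦ 2₃ ⟧₃ = - 1#

  ⟦⟧-homo-+ : ∀ x y → ⟦ x +₃ y ⟧₃ ≈ ⟦ x ⟧₃ + ⟦ y ⟧₃
  ⟦⟧-homo-+ 0₃ y  = sym (+-identityˡ _)
  ⟦⟧-homo-+ 1₃ 0₃ = sym (+-identityʳ _)
  ⟦⟧-homo-+ 1₃ 1₃ = sym 1+1≈-1
  ⟦⟧-homo-+ 1₃ 2₃ = sym (-‿inverseʳ 1#)
  ⟦⟧-homo-+ 2₃ 0₃ = sym (+-identityʳ _)
  ⟦⟧-homo-+ 2₃ 1₃ = sym (-‿inverseˡ 1#)
  ⟦⟧-homo-+ 2₃ 2₃ = sym (trans (-‿+-comm 1# 1#) (trans (-‿cong 1+1≈-1) (-‿involutive 1#)))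

  ⟦⟧-homo-* : ∀ x y → ⟦ x *₃ y ⟧₃ ≈ ⟦ x ⟧₃ * ⟦ y ⟧₃
  ⟦⟧-homo-* 0₃ y  = sym (zeroˡ _)
  ⟦⟧-homo-* 1₃ y  = sym (*-identityˡ _)
  ⟦⟧-homo-* 2₃ 0₃ = sym (zeroʳ _)
  ⟦⟧-homo-* 2₃ 1₃ = sym (*-identityʳ _)
  ⟦⟧-homo-* 2₃ 2₃ = trans (sym (-‿involutive 1#)) (trans (-‿cong (sym (*-identityˡ (- 1#)))) (-‿distribˡ-* 1# (- 1#)))

  ⟦⟧-homo-- : ∀ x → ⟦ -₃ x ⟧₃ ≈ - ⟦ x ⟧₃
  ⟦⟧-homo-- 0₃ = sym -0#≈0#
  ⟦⟧-homo-- 1₃ = refl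
  ⟦⟧-homo-- 2₃ = sym (-‿involutive 1#)

  𝔽₃-morphism : 𝔽₃-rawRing ACR.-Raw-AlmostCommutative⟶ ACR.fromCommutativeRing commRing
  𝔽₃-morphism = record
    { ⟦_⟧ = ⟦_⟧₃ ; +-homo = ⟦⟧-homo-+ ; *-homo = ⟦⟧-homo-* ; -‿homo = ⟦⟧-homo--
    ; 0-homo = refl ; 1-homo = refl }

  ⟦⟧-≟ : ∀ x y → Maybe (⟦ x ⟧₃ ≈ ⟦ y ⟧₃)
  ⟦⟧-≟ x y with x ≟₃ y
  ... | just PE.refl = just refl
  ... | nothing      = nothing

  open RingSolver 𝔽₃-rawRing (ACR.fromCommutativeRing commRing) 𝔽₃-morphism ⟦⟧-≟
    using (solve; _:=_; _:+_; _:*_; :-_; _:-_; con)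

  σ : Carrier → Carrier
  σ x = x ^′ 3

  σ^ : ℕ → Carrier → Carrier
  σ^ i x = x ^′ (3 ^ i)

  σ-cong : ∀ {x y} → x ≈ y → σ x ≈ σ y
  σ-cong = ^′-congˡ 3

  σ-+ : ∀ x y → σ (x + y) ≈ σ x + σ y
  σ-+ = solve 2 (λ x y → (x :+ y) :* ((x :+ y) :* ((x :+ y) :* con 1₃))
                        := x :* (x :* (x :* con 1₃)) :+ y :* (y :* (y :* con 1₃))) refl

  σ-* : ∀ x y → σ (x * y) ≈ σ x * σ y
  σ-* x y = ^′-distrib-* x y 3

  σ-- : ∀ x → σ (- x) ≈ - σ x
  σ-- = solve 1 (λ x → (:- x) :* ((:- x) :* ((:- x) :* con 1₃)) := :- (x :* (x :* (x :* con 1₃)))) refl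

  σ-Σ< : ∀ n (g : ℕ → Carrier) → σ (Σ< n g) ≈ Σ< n (λ i → σ (g i))
  σ-Σ< zero    g = zeroˡ _
  σ-Σ< (suc n) g = trans (σ-+ _ _) (+-congʳ (σ-Σ< n g))

  σ^-cong : ∀ i {x y} → x ≈ y → σ^ i x ≈ σ^ i y
  σ^-cong i = ^′-congˡ (3 ^ i)

  σ^-suc-inner : ∀ i x → σ^ (suc i) x ≈ σ^ i (σ x)
  σ^-suc-inner i x = sym (^′-assocʳ x 3 (3 ^ i))

  σ^-suc-outer : ∀ i x → σ^ (suc i) x ≈ σ (σ^ i x)
  σ^-suc-outer i x = trans (^′-congʳ x (ℕP.*-comm 3 (3 ^ i))) (sym (^′-assocʳ x (3 ^ i) 3))

  σ^-+ : ∀ i x y → σ^ i (x + y) ≈ σ^ i x + σ^ i y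
  σ^-+ zero    x y = trans (*-identityʳ _) (sym (+-cong (*-identityʳ x) (*-identityʳ y)))
  σ^-+ (suc i) x y = begin
    σ^ (suc i) (x + y)          ≈⟨ σ^-suc-outer i (x + y) ⟩
    σ (σ^ i (x + y))            ≈⟨ σ-cong (σ^-+ i x y) ⟩
    σ (σ^ i x + σ^ i y)         ≈⟨ σ-+ _ _ ⟩
    σ (σ^ i x) + σ (σ^ i y)     ≈⟨ +-cong (sym (σ^-suc-outer i x)) (sym (σ^-suc-outer i y)) ⟩
    σ^ (suc i) x + σ^ (suc i) y ∎

  σ^-* : ∀ i x y → σ^ i (x * y) ≈ σ^ i x * σ^ i y
  σ^-* i x y = ^′-distrib-* x y (3 ^ i)

  σ^-0 : ∀ i → σ^ i 0# ≈ 0#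
  σ^-0 i = 0^′ (ℕP.m^n>0 3 i)

  σ^-fixed : ∀ i z → σ z ≈ z → σ^ i z ≈ z
  σ^-fixed zero    z p = *-identityʳ z
  σ^-fixed (suc i) z p = trans (σ^-suc-outer i z) (trans (σ-cong (σ^-fixed i z p)) p)

  Tr-cong : ∀ {x y} → x ≈ y → Tr s x ≈ Tr s y
  Tr-cong p = Σ<-cong s (λ i → σ^-cong i p)

  Tr-+ : ∀ x y → Tr s (x + y) ≈ Tr s x + Tr s y
  Tr-+ x y = trans (Σ<-cong s (λ i → σ^-+ i x y)) (Σ<-+ s _ _)

  Tr-0 : Tr s 0# ≈ 0#
  Tr-0 = Σ<-zero s _ (λ i _ → σ^-0 i)

  Tr-- : ∀ x → Tr s (- x) ≈ - Tr s x
  Tr-- x = +-inverseˡ-unique _ _ (trans (sym (Tr-+ (- x) x)) (trans (Tr-cong (-‿inverseˡ x)) Tr-0))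

  Tr-scale : ∀ z x → σ z ≈ z → Tr s (z * x) ≈ z * Tr s x
  Tr-scale z x p = trans (Σ<-cong s (λ i → trans (σ^-* i z x) (*-congʳ (σ^-fixed i z p)))) (Σ<-*ˡ s z _)

  -- the sum σ x + … + σ^s x is again Tr x, because σ^ s x = x by Fermat's little theorem
  Tr-shifted : ∀ x → Σ< s (λ i → σ^ (suc i) x) ≈ Tr s x
  Tr-shifted x = +-cancelˡ (σ^ 0 x) _ _ (begin
    σ^ 0 x + Σ< s (λ i → σ^ (suc i) x) ≈⟨ sym (Σ<-shift s (λ i → σ^ i x)) ⟩
    Tr s x + σ^ s x                    ≈⟨ +-congˡ (trans (fermat x) (sym (*-identityʳ x))) ⟩
    Tr s x + σ^ 0 x                    ≈⟨ +-comm _ _ ⟩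
    σ^ 0 x + Tr s x                    ∎)

  Tr-σ : ∀ x → Tr s (σ x) ≈ Tr s x
  Tr-σ x = trans (Σ<-cong s (λ i → sym (σ^-suc-inner i x))) (Tr-shifted x)

  Tr-in-𝔽₃ : ∀ x → σ (Tr s x) ≈ Tr s x
  Tr-in-𝔽₃ x = trans (σ-Σ< s _) (trans (Σ<-cong s (λ i → sym (σ^-suc-outer i x))) (Tr-shifted x))

  Tr-artinSchreier : ∀ y → Tr s (σ y - y) ≈ 0#
  Tr-artinSchreier y = begin
    Tr s (σ y - y)          ≈⟨ Tr-+ _ _ ⟩
    Tr s (σ y) + Tr s (- y) ≈⟨ +-cong (Tr-σ y) (Tr-- y) ⟩
    Tr s y - Tr s y         ≈⟨ -‿inverseʳ _ ⟩
    0#                      ∎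

  -- Polynomials as coefficient lists [c₀, c₁, …], lowest degree first.
  -- `eval cs` evaluates by Horner's rule, `evalMonic cs` evaluates the monic
  -- polynomial cs + X^(length cs).

  eval : List Carrier → Carrier → Carrier
  eval []       x = 0#
  eval (c ∷ cs) x = c + x * eval cs x

  evalMonic : List Carrier → Carrier → Carrier
  evalMonic []       x = 1#
  evalMonic (c ∷ cs) x = c + x * evalMonic cs x

  evalMonic≈eval+power : ∀ cs x → evalMonic cs x ≈ eval cs x + x ^′ length cs
  evalMonic≈eval+power []       x = sym (+-identityˡ _)
  evalMonic≈eval+power (c ∷ cs) x = trans (+-congˡ (*-congˡ (evalMonic≈eval+power cs x)))
    (solve 4 (λ c x e p → c :+ x :* (e :+ p) := (c :+ x :* e) :+ x :* p) refl c x (eval cs x) (x ^′ length cs))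

  divLinear : List Carrier → Carrier → List Carrier
  divLinear []            r = []
  divLinear (c ∷ [])      r = []
  divLinear (c ∷ c′ ∷ cs) r = evalMonic (c′ ∷ cs) r ∷ divLinear (c′ ∷ cs) r

  divLinear-length : ∀ c cs r → length (divLinear (c ∷ cs) r) ≡ length cs
  divLinear-length c []        r = PE.refl
  divLinear-length c (c′ ∷ cs) r = PE.cong suc (divLinear-length c′ cs r)

  divLinear-eval : ∀ c cs r x →
    evalMonic (c ∷ cs) x ≈ (x - r) * evalMonic (divLinear (c ∷ cs) r) x + evalMonic (c ∷ cs) r
  divLinear-eval c [] r x =
    solve 3 (λ c r x → c :+ x :* con 1₃ := (x :- r) :* con 1₃ :+ (c :+ r :* con 1₃)) refl c r x
  divLinear-eval c (c′ ∷ cs) r x = begin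
    c + x * p x                       ≈⟨ +-congˡ (*-congˡ (divLinear-eval c′ cs r x)) ⟩
    c + x * ((x - r) * p/ + p r)      ≈⟨ solve 5 (λ c x r d m → c :+ x :* ((x :- r) :* d :+ m)
                                           := (x :- r) :* (m :+ x :* d) :+ (c :+ r :* m)) refl c x r p/ (p r) ⟩
    (x - r) * (p r + x * p/) + (c + r * p r) ∎
    where
    p = evalMonic (c′ ∷ cs)
    p/ = evalMonic (divLinear (c′ ∷ cs) r) x

  root-bound : ∀ n (cs : List Carrier) (root : Fin n → Carrier) → (∀ {i j} → root i ≈ root j → i ≡ j) →
    (∀ i → evalMonic cs (root i) ≈ 0#) → n ℕ.≤ length cs
  root-bound zero    cs       root distinct isRoot = z≤n
  root-bound (suc n) []       root distinct isRoot = ⊥-elim (1≉0 (isRoot zero))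
  root-bound (suc n) (c ∷ cs) root distinct isRoot =
    s≤s (PE.subst (n ℕ.≤_) (divLinear-length c cs r)
      (root-bound n (divLinear (c ∷ cs) r) (λ i → root (suc i)) (λ p → FinP.suc-injective (distinct p)) quotient-roots))
    where
    r = root zero
    -- the other roots are roots of the quotient, since x - r ≠ 0 for them
    quotient-roots : ∀ i → evalMonic (divLinear (c ∷ cs) r) (root (suc i)) ≈ 0#
    quotient-roots i = nonzero-cancelˡ (λ d≈0 → 0≢suc (distinct (x∙y⁻¹≈ε⇒x≈y _ _ d≈0))) (begin
      (x - r) * evalMonic (divLinear (c ∷ cs) r) x       ≈⟨ sym (+-identityʳ _) ⟩
      (x - r) * evalMonic (divLinear (c ∷ cs) r) x + 0# ≈⟨ +-congˡ (sym (isRoot zero)) ⟩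
      (x - r) * evalMonic (divLinear (c ∷ cs) r) x + evalMonic (c ∷ cs) r
                                                        ≈⟨ sym (divLinear-eval c cs r x) ⟩
      evalMonic (c ∷ cs) x                              ≈⟨ isRoot (suc i) ⟩
      0#                                                ∎)
      where
      x = root (suc i)
      0≢suc : suc i ≢ zero
      0≢suc ()

  eval-++ : ∀ as bs x → eval (as ++ bs) x ≈ eval as x + x ^′ length as * eval bs x
  eval-++ []       bs x = solve 1 (λ b → b := con 0₃ :+ con 1₃ :* b) refl (eval bs x)
  eval-++ (a ∷ as) bs x = trans (+-congˡ (*-congˡ (eval-++ as bs x)))
    (solve 5 (λ a x e p b → a :+ x :* (e :+ p :* b) := (a :+ x :* e) :+ (x :* p) :* b) refl
      a x (eval as x) (x ^′ length as) (eval bs x))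

  eval-zeros : ∀ k x → eval (replicate k 0#) x ≈ 0#
  eval-zeros zero    x = refl
  eval-zeros (suc k) x = trans (+-identityˡ _) (trans (*-congˡ (eval-zeros k x)) (zeroʳ x))

  pad : ℕ → List Carrier → List Carrier
  pad n cs = cs ++ replicate (n ℕ.∸ length cs) 0#

  pad-length : ∀ n cs → length cs ℕ.≤ n → length (pad n cs) ≡ n
  pad-length n cs le = PE.trans (ListP.length-++ cs)
    (PE.trans (PE.cong (length cs ℕ.+_) (ListP.length-replicate (n ℕ.∸ length cs))) (ℕP.m+[n∸m]≡n le))

  eval-pad : ∀ n cs x → eval (pad n cs) x ≈ eval cs x
  eval-pad n cs x = trans (eval-++ cs _ x)
    (trans (+-congˡ (trans (*-congˡ (eval-zeros (n ℕ.∸ length cs) x)) (zeroʳ _))) (+-identityʳ _))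

  traceCoefficients : ℕ → List Carrier
  traceCoefficients zero    = []
  traceCoefficients (suc t) = pad (3 ^ t) (traceCoefficients t) ++ (1# ∷ [])

  traceCoefficients-length : ∀ t → length (traceCoefficients t) ℕ.≤ 3 ^ t
  traceCoefficients-length zero    = z≤n
  traceCoefficients-length (suc t) = PE.subst (ℕ._≤ 3 ^ suc t) (PE.sym length≡) (ℕP.+-monoʳ-≤ (3 ^ t) 1≤2·3^t)
    where
    length≡ : length (traceCoefficients (suc t)) ≡ 3 ^ t ℕ.+ 1
    length≡ = PE.trans (ListP.length-++ (pad (3 ^ t) (traceCoefficients t)))
      (PE.cong (ℕ._+ 1) (pad-length (3 ^ t) (traceCoefficients t) (traceCoefficients-length t)))
    1≤2·3^t : 1 ℕ.≤ 3 ^ t ℕ.+ (3 ^ t ℕ.+ 0)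
    1≤2·3^t = ℕP.≤-trans (ℕP.m^n>0 3 t) (ℕP.m≤m+n (3 ^ t) _)

  traceCoefficients-eval : ∀ t x → eval (traceCoefficients t) x ≈ Tr t x
  traceCoefficients-eval zero    x = refl
  traceCoefficients-eval (suc t) x = begin
    eval (pad (3 ^ t) cs ++ (1# ∷ [])) x               ≈⟨ eval-++ (pad (3 ^ t) cs) _ x ⟩
    eval (pad (3 ^ t) cs) x + x ^′ length (pad (3 ^ t) cs) * (1# + x * 0#)
                                                       ≈⟨ +-cong (trans (eval-pad (3 ^ t) cs x) (traceCoefficients-eval t x)) top ⟩
    Tr t x + σ^ t x                                    ∎
    where
    cs = traceCoefficients t
    top : x ^′ length (pad (3 ^ t) cs) * (1# + x * 0#) ≈ σ^ t x
    top = trans (*-congˡ (trans (+-congˡ (zeroʳ x)) (+-identityʳ _)))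
            (trans (*-identityʳ _) (^′-congʳ x (pad-length (3 ^ t) cs (traceCoefficients-length t))))

  tracePolynomial : ℕ → List Carrier
  tracePolynomial t = pad (3 ^ t) (traceCoefficients t)

  tracePolynomial-degree : ∀ t → length (tracePolynomial t) ≡ 3 ^ t
  tracePolynomial-degree t = pad-length (3 ^ t) (traceCoefficients t) (traceCoefficients-length t)

  tracePolynomial-eval : ∀ t x → evalMonic (tracePolynomial t) x ≈ Tr (suc t) x
  tracePolynomial-eval t x = trans (evalMonic≈eval+power (tracePolynomial t) x)
    (+-cong (trans (eval-pad (3 ^ t) (traceCoefficients t) x) (traceCoefficients-eval t x))
            (^′-congʳ x (tracePolynomial-degree t)))

  -- s ≥ 1, since the field has at least two elements
  s≡1+ : Σ ℕ λ t → s ≡ suc t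
  s≡1+ = positive s 2≤q
    where
    positive : ∀ n → 2 ℕ.≤ 3 ^ n → Σ ℕ λ t → n ≡ suc t
    positive zero    (s≤s ())
    positive (suc t) _ = t , PE.refl

  -- The trace is not identically zero: Tr = Tr (t + 1) is given by a monic
  -- polynomial of degree 3^t < q, which cannot vanish on all of 𝔽_q.
  Tr-nonzero : Σ Carrier λ w → ¬ (Tr s w ≈ 0#)
  Tr-nonzero with FinP.any? (λ i → ¬? (Tr s (elem i) ≈? 0#))
  ... | yes (i , Tr≉0) = elem i , Tr≉0
  ... | no none = ⊥-elim (ℕP.<⇒≱ 3^t<q (PE.subst (ℕ._≤ 3 ^ t) (PE.cong (3 ^_) s≡1+t) q≤3^t))
    where
    t = proj₁ s≡1+
    s≡1+t = proj₂ s≡1+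
    all-zero : ∀ i → Tr (suc t) (elem i) ≈ 0#
    all-zero i with Tr s (elem i) ≈? 0#
    ... | yes Tr≈0 = PE.subst (λ n → Tr n (elem i) ≈ 0#) s≡1+t Tr≈0
    ... | no Tr≉0  = ⊥-elim (none (i , Tr≉0))
    q≤3^t : 3 ^ s ℕ.≤ 3 ^ t
    q≤3^t = PE.subst (3 ^ s ℕ.≤_) (tracePolynomial-degree t)
      (root-bound (3 ^ s) (tracePolynomial t) elem elem-injective
        (λ i → trans (tracePolynomial-eval t (elem i)) (all-zero i)))
    3^t<q : 3 ^ t ℕ.< 3 ^ suc t
    3^t<q = ℕP.^-monoʳ-< 3 (s≤s (s≤s z≤n)) (ℕP.n<1+n t)

  -- Some element has trace 1: if Tr w = z ≠ 0 then σ z = z, so z² = 1 and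
  -- Tr (z w) = z² = 1.
  Tr-one : Σ Carrier λ w → Tr s w ≈ 1#
  Tr-one = z * w , trans (Tr-scale z w (Tr-in-𝔽₃ w)) z²≈1
    where
    w = proj₁ Tr-nonzero
    z = Tr s w
    z³-z≈0 : z * (z * z - 1#) ≈ 0#
    z³-z≈0 = begin
      z * (z * z - 1#) ≈⟨ solve 1 (λ z → z :* (z :* z :- con 1₃) := z :* (z :* (z :* con 1₃)) :- z) refl z ⟩
      σ z - z          ≈⟨ +-congʳ (Tr-in-𝔽₃ w) ⟩
      z - z            ≈⟨ -‿inverseʳ z ⟩
      0#               ∎
    z²≈1 : z * z ≈ 1#
    z²≈1 = x∙y⁻¹≈ε⇒x≈y _ _ (nonzero-cancelˡ (proj₂ Tr-nonzero) z³-z≈0)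

  -- Additive Hilbert 90: an element of trace zero is an Artin–Schreier
  -- element.  With Tr w = 1 and Sᵢ = Σ_{j<i} σ^ j c, the element
  -- y = Σ_{i<s} Sᵢ · σ^ i w satisfies σ y = y - c.
  hilbert90 : ∀ c → Tr s c ≈ 0# → Σ Carrier λ y → σ y - y ≈ c
  hilbert90 c Tr≈0 = - y , result
    where
    w = proj₁ Tr-one
    S : ℕ → Carrier
    S i = Σ< i (λ j → σ^ j c)
    term : ℕ → Carrier
    term i = S i * σ^ i w
    y = Σ< s term
    σS : ∀ i → σ (S i) ≈ S (suc i) - c
    σS i = begin
      σ (S i)                          ≈⟨ σ-Σ< i _ ⟩
      Σ< i (λ j → σ (σ^ j c))          ≈⟨ Σ<-cong i (λ j → sym (σ^-suc-outer j c)) ⟩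
      Σ< i (λ j → σ^ (suc j) c)        ≈⟨ solve 2 (λ a c → a := (c :+ a) :- c) refl _ c ⟩
      (c + Σ< i (λ j → σ^ (suc j) c)) - c
                                       ≈⟨ +-congʳ (sym (trans (Σ<-shift i (λ j → σ^ j c)) (+-congʳ (*-identityʳ c)))) ⟩
      S (suc i) - c                    ∎
    σterm : ∀ i → σ (term i) ≈ term (suc i) + (- c) * σ^ (suc i) w
    σterm i = begin
      σ (term i)                          ≈⟨ σ-* _ _ ⟩
      σ (S i) * σ (σ^ i w)                ≈⟨ *-cong (σS i) (sym (σ^-suc-outer i w)) ⟩
      (S (suc i) - c) * σ^ (suc i) w      ≈⟨ distribʳ _ _ _ ⟩
      term (suc i) + (- c) * σ^ (suc i) w ∎
    -- the shifted sum of terms is y again, since term 0 = 0 and S s = Tr c = 0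
    term-shifted : Σ< s (λ i → term (suc i)) ≈ y
    term-shifted = +-cancelˡ (term 0) _ _ (begin
      term 0 + Σ< s (λ i → term (suc i)) ≈⟨ sym (Σ<-shift s term) ⟩
      y + S s * σ^ s w                   ≈⟨ +-congˡ (trans (*-congʳ Tr≈0) (zeroˡ _)) ⟩
      y + 0#                             ≈⟨ +-identityʳ y ⟩
      y                                  ≈⟨ sym (+-identityˡ y) ⟩
      0# + y                             ≈⟨ +-congʳ (sym (zeroˡ _)) ⟩
      term 0 + y                         ∎)
    σy : σ y ≈ y - c
    σy = begin
      σ y                                                     ≈⟨ σ-Σ< s term ⟩
      Σ< s (λ i → σ (term i))                                 ≈⟨ Σ<-cong s σterm ⟩
      Σ< s (λ i → term (suc i) + (- c) * σ^ (suc i) w)        ≈⟨ Σ<-+ s _ _ ⟩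
      Σ< s (λ i → term (suc i)) + Σ< s (λ i → (- c) * σ^ (suc i) w)
                                                              ≈⟨ +-cong term-shifted (Σ<-*ˡ s (- c) _) ⟩
      y + (- c) * Σ< s (λ i → σ^ (suc i) w)                   ≈⟨ +-congˡ (*-congˡ (trans (Tr-shifted w) (proj₂ Tr-one))) ⟩
      y + (- c) * 1#                                          ≈⟨ +-congˡ (*-identityʳ _) ⟩
      y - c                                                   ∎
    result : σ (- y) - (- y) ≈ c
    result = begin
      σ (- y) - (- y)   ≈⟨ +-congʳ (trans (σ-- y) (-‿cong σy)) ⟩
      - (y - c) - (- y) ≈⟨ solve 2 (λ y c → (:- (y :- c)) :- (:- y) := c) refl y c ⟩
      c                 ∎

  -- Cubics: irreducible iff rootless.

  cubicValue : Carrier → Carrier → Carrier → Carrier → Carrier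
  cubicValue a₂ a₁ a₀ r = ((σ r - a₂ * (r * r)) - a₁ * r) - a₀

  cubicValue-cong : ∀ a₂ a₁ a₀ {r r′} → r ≈ r′ → cubicValue a₂ a₁ a₀ r ≈ cubicValue a₂ a₁ a₀ r′
  cubicValue-cong a₂ a₁ a₀ p = +-congʳ (+-cong (+-cong (σ-cong p) (-‿cong (*-congˡ (*-cong p p)))) (-‿cong (*-congˡ p)))

  cubicValue-via : ∀ a₂ a₁ a₀ r (p : Poly) → (∀ k → p k ≈ cubic a₂ a₁ a₀ k) →
    cubicValue a₂ a₁ a₀ r ≈ ((p 3 * σ r + p 2 * (r * r)) + p 1 * r) + p 0
  cubicValue-via a₂ a₁ a₀ r p coeff = begin
    cubicValue a₂ a₁ a₀ r
      ≈⟨ solve 4 (λ a₂ a₁ a₀ r → ((r :* (r :* (r :* con 1₃)) :- a₂ :* (r :* r)) :- a₁ :* r) :- a₀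
           := ((con 1₃ :* (r :* (r :* (r :* con 1₃))) :+ (:- a₂) :* (r :* r)) :+ (:- a₁) :* r) :+ (:- a₀)) refl a₂ a₁ a₀ r ⟩
    ((1# * σ r + (- a₂) * (r * r)) + (- a₁) * r) + (- a₀)
      ≈⟨ sym (+-cong (+-cong (+-cong (*-congʳ (coeff 3)) (*-congʳ (coeff 2))) (*-congʳ (coeff 1))) (coeff 0)) ⟩
    ((p 3 * σ r + p 2 * (r * r)) + p 1 * r) + p 0 ∎

  cubic-beyond-3 : ∀ a₂ a₁ a₀ k → 3 ℕ.< k → cubic a₂ a₁ a₀ k ≈ 0#
  cubic-beyond-3 a₂ a₁ a₀ (suc (suc (suc (suc k)))) _ = refl
  cubic-beyond-3 a₂ a₁ a₀ (suc (suc (suc zero))) (s≤s (s≤s (s≤s ())))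
  cubic-beyond-3 a₂ a₁ a₀ (suc (suc zero)) (s≤s (s≤s ()))
  cubic-beyond-3 a₂ a₁ a₀ (suc zero) (s≤s ())

  -- A root r gives the factorisation f = (X - r)(X² + (r - a₂)X + (r² - a₂r - a₁)).
  irreducible⇒rootless : ∀ a₂ a₁ a₀ → Irreducible (cubic a₂ a₁ a₀) → ∀ r → ¬ (cubicValue a₂ a₁ a₀ r ≈ 0#)
  irreducible⇒rootless a₂ a₁ a₀ irreducible r root =
    irreducible (g , h , 1 , 2 , s≤s z≤n , s≤s z≤n , (1≉0 , g-vanishes) , (1≉0 , h-vanishes) , coefficients)
    where
    g h : Poly
    g zero          = - r
    g (suc zero)    = 1#
    g (suc (suc _)) = 0#
    h zero                = (r * r - a₂ * r) - a₁
    h (suc zero)          = r - a₂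
    h (suc (suc zero))    = 1#
    h (suc (suc (suc _))) = 0#
    g-vanishes : ∀ i → 1 ℕ.< i → g i ≈ 0#
    g-vanishes (suc (suc i)) _ = refl
    g-vanishes (suc zero) (s≤s ())
    h-vanishes : ∀ i → 2 ℕ.< i → h i ≈ 0#
    h-vanishes (suc (suc (suc i))) _ = refl
    h-vanishes (suc (suc zero)) (s≤s (s≤s ()))
    h-vanishes (suc zero) (s≤s ())
    coefficients : ∀ k → (g · h) k ≈ cubic a₂ a₁ a₀ k
    coefficients zero = begin
      0# + (- r) * ((r * r - a₂ * r) - a₁)
        ≈⟨ solve 4 (λ r a₂ a₁ a₀ → con 0₃ :+ (:- r) :* ((r :* r :- a₂ :* r) :- a₁)
             := (:- a₀) :- (((r :* (r :* (r :* con 1₃)) :- a₂ :* (r :* r)) :- a₁ :* r) :- a₀)) refl r a₂ a₁ a₀ ⟩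
      (- a₀) - cubicValue a₂ a₁ a₀ r ≈⟨ +-congˡ (trans (-‿cong root) -0#≈0#) ⟩
      (- a₀) + 0#                    ≈⟨ +-identityʳ _ ⟩
      - a₀                           ∎
    coefficients (suc zero) =
      solve 3 (λ r a₂ a₁ → (con 0₃ :+ (:- r) :* (r :- a₂)) :+ con 1₃ :* ((r :* r :- a₂ :* r) :- a₁) := :- a₁) refl r a₂ a₁
    coefficients (suc (suc zero)) =
      solve 3 (λ r a₂ a₁ → ((con 0₃ :+ (:- r) :* con 1₃) :+ con 1₃ :* (r :- a₂)) :+ con 0₃ :* ((r :* r :- a₂ :* r) :- a₁)
                := :- a₂) refl r a₂ a₁
    coefficients (suc (suc (suc zero))) =
      solve 3 (λ r a₂ a₁ → (((con 0₃ :+ (:- r) :* con 0₃) :+ con 1₃ :* con 1₃) :+ con 0₃ :* (r :- a₂))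
                  :+ con 0₃ :* ((r :* r :- a₂ :* r) :- a₁) := con 1₃) refl r a₂ a₁
    coefficients (suc (suc (suc (suc k)))) = Σ<-zero (suc (suc (suc (suc (suc k))))) _ term
      where
      term : ∀ i → i ℕ.< suc (suc (suc (suc (suc k)))) → g i * h (suc (suc (suc (suc k))) ℕ.∸ i) ≈ 0#
      term zero          _ = zeroʳ _
      term (suc zero)    _ = zeroʳ _
      term (suc (suc i)) _ = zeroˡ _

  linear-root : ∀ g₀ g₁ → ¬ (g₁ ≈ 0#) → g₀ + g₁ * (- g₀ * g₁ ⁻¹) ≈ 0#
  linear-root g₀ g₁ g₁≉0 = begin
    g₀ + g₁ * (- g₀ * g₁ ⁻¹) ≈⟨ solve 3 (λ u v w → u :+ v :* ((:- u) :* w) := u :- u :* (w :* v)) refl g₀ g₁ (g₁ ⁻¹) ⟩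
    g₀ - g₀ * (g₁ ⁻¹ * g₁)   ≈⟨ +-congˡ (-‿cong (trans (*-congˡ (inverseˡ g₁ g₁≉0)) (*-identityʳ g₀))) ⟩
    g₀ - g₀                  ≈⟨ -‿inverseʳ g₀ ⟩
    0#                       ∎

  degrees-1-2 : ∀ {dg dh} → 1 ℕ.≤ dg → 1 ℕ.≤ dh → dg ℕ.+ dh ≡ 3 → (dg ≡ 1 × dh ≡ 2) ⊎ (dg ≡ 2 × dh ≡ 1)
  degrees-1-2 {1} {2} _ _ _ = inj₁ (PE.refl , PE.refl)
  degrees-1-2 {2} {1} _ _ _ = inj₂ (PE.refl , PE.refl)
  degrees-1-2 {1} {1} _ _ ()
  degrees-1-2 {1} {suc (suc (suc _))} _ _ ()
  degrees-1-2 {2} {suc (suc _)} _ _ ()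
  degrees-1-2 {suc (suc (suc a))} {suc b} _ _ e =
    ⊥-elim (ℕP.1+n≢0 (PE.trans (PE.sym (ℕP.+-suc a b)) (ℕP.suc-injective (ℕP.suc-injective (ℕP.suc-injective e)))))

  module Factorisation (a₂ a₁ a₀ : Carrier) (g h : Poly) (product : ∀ k → (g · h) k ≈ cubic a₂ a₁ a₀ k) where

    linear×quadratic : HasDegree g 1 → HasDegree h 2 → Σ Carrier λ r → cubicValue a₂ a₁ a₀ r ≈ 0#
    linear×quadratic (g₁≉0 , g-vanishes) (_ , h-vanishes) = r , (begin
      cubicValue a₂ a₁ a₀ r ≈⟨ cubicValue-via a₂ a₁ a₀ r (g · h) product ⟩
      _ ≈⟨ +-cong (+-cong (+-cong (*-congʳ (+-cong (+-cong (+-cong (+-congˡ (*-congˡ (h-vanishes 3 ℕP.≤-refl))) refl)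
                                                                  (*-congʳ (g-vanishes 2 ℕP.≤-refl)))
                                                          (*-congʳ (g-vanishes 3 (s≤s (s≤s z≤n))))))
                                 (*-congʳ (+-congˡ (*-congʳ (g-vanishes 2 ℕP.≤-refl)))))
                          refl) refl ⟩
      _ ≈⟨ solve 6 (λ g0 g1 h0 h1 h2 r →
             (((((con 0₃ :+ g0 :* con 0₃) :+ g1 :* h2) :+ con 0₃ :* h1) :+ con 0₃ :* h0) :* (r :* (r :* (r :* con 1₃)))
              :+ (((con 0₃ :+ g0 :* h2) :+ g1 :* h1) :+ con 0₃ :* h0) :* (r :* r)
              :+ ((con 0₃ :+ g0 :* h1) :+ g1 :* h0) :* r)
              :+ (con 0₃ :+ g0 :* h0)
             := (g0 :+ g1 :* r) :* (h0 :+ h1 :* r :+ h2 :* (r :* r))) refl (g 0) (g 1) (h 0) (h 1) (h 2) r ⟩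
      (g 0 + g 1 * r) * (h 0 + h 1 * r + h 2 * (r * r)) ≈⟨ *-congʳ (linear-root (g 0) (g 1) g₁≉0) ⟩
      0# * _                                            ≈⟨ zeroˡ _ ⟩
      0#                                                ∎)
      where
      r = - (g 0) * (g 1) ⁻¹

    quadratic×linear : HasDegree g 2 → HasDegree h 1 → Σ Carrier λ r → cubicValue a₂ a₁ a₀ r ≈ 0#
    quadratic×linear (_ , g-vanishes) (h₁≉0 , h-vanishes) = r , (begin
      cubicValue a₂ a₁ a₀ r ≈⟨ cubicValue-via a₂ a₁ a₀ r (g · h) product ⟩
      _ ≈⟨ +-cong (+-cong (+-cong (*-congʳ (+-cong (+-cong (+-cong (+-congˡ (*-congˡ (h-vanishes 3 (s≤s (s≤s z≤n)))))
                                                                           (*-congˡ (h-vanishes 2 ℕP.≤-refl)))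
                                                                   refl)
                                                          (*-congʳ (g-vanishes 3 ℕP.≤-refl))))
                                 (*-congʳ (+-congʳ (+-congʳ (+-congˡ (*-congˡ (h-vanishes 2 ℕP.≤-refl)))))))
                          refl) refl ⟩
      _ ≈⟨ solve 6 (λ g0 g1 g2 h0 h1 r →
             (((((con 0₃ :+ g0 :* con 0₃) :+ g1 :* con 0₃) :+ g2 :* h1) :+ con 0₃ :* h0) :* (r :* (r :* (r :* con 1₃)))
              :+ (((con 0₃ :+ g0 :* con 0₃) :+ g1 :* h1) :+ g2 :* h0) :* (r :* r)
              :+ ((con 0₃ :+ g0 :* h1) :+ g1 :* h0) :* r)
              :+ (con 0₃ :+ g0 :* h0)
             := (g0 :+ g1 :* r :+ g2 :* (r :* r)) :* (h0 :+ h1 :* r)) refl (g 0) (g 1) (g 2) (h 0) (h 1) r ⟩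
      (g 0 + g 1 * r + g 2 * (r * r)) * (h 0 + h 1 * r) ≈⟨ *-congˡ (linear-root (h 0) (h 1) h₁≉0) ⟩
      _ * 0#                                            ≈⟨ zeroʳ _ ⟩
      0#                                                ∎)
      where
      r = - (h 0) * (h 1) ⁻¹

  -- A rootless cubic is irreducible: comparing coefficients 3 and dg + dh
  -- forces deg g + deg h = 3, and then one factor is linear.
  rootless⇒irreducible : ∀ a₂ a₁ a₀ → (∀ r → ¬ (cubicValue a₂ a₁ a₀ r ≈ 0#)) → Irreducible (cubic a₂ a₁ a₀)
  rootless⇒irreducible a₂ a₁ a₀ rootless (g , h , dg , dh , 1≤dg , 1≤dh , deg-g , deg-h , product)
    with ℕP.<-cmp (dg ℕ.+ dh) 3
  ... | tri< lt _ _ = 1≉0 (trans (sym (product 3)) (coefficient-beyond 3 lt))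
    where open ProductDegree g h dg dh (proj₂ deg-g) (proj₂ deg-h)
  ... | tri> _ _ gt = *-nonzero (proj₁ deg-g) (proj₁ deg-h)
                        (trans (sym leading-coefficient) (trans (product _) (cubic-beyond-3 a₂ a₁ a₀ _ gt)))
    where open ProductDegree g h dg dh (proj₂ deg-g) (proj₂ deg-h)
  ... | tri≈ _ sum≡3 _ with degrees-1-2 1≤dg 1≤dh sum≡3
  ...   | inj₁ (PE.refl , PE.refl) = rootless _ (proj₂ (Factorisation.linear×quadratic a₂ a₁ a₀ g h product deg-g deg-h))
  ...   | inj₂ (PE.refl , PE.refl) = rootless _ (proj₂ (Factorisation.quadratic×linear a₂ a₁ a₀ g h product deg-g deg-h))

  depressed : Carrier → Carrier → Carrier → Carrier
  depressed A₁ A₀ z = (σ z - A₁ * z) - A₀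

  Condition₁ : Carrier → Carrier → Set (c ⊔ ℓ)
  Condition₁ A₁ A₀ = Σ Carrier λ b → (A₁ ≈ (b * b)) × ¬ (Tr s (A₀ / (b ^′ 3)) ≈ 0#)

  cubicValue-a₂≈0 : ∀ a₂ a₁ a₀ r → a₂ ≈ 0# → cubicValue a₂ a₁ a₀ r ≈ depressed a₁ a₀ r
  cubicValue-a₂≈0 a₂ a₁ a₀ r a₂≈0 = +-congʳ (+-congʳ
    (trans (+-congˡ (trans (-‿cong (trans (*-congʳ a₂≈0) (zeroˡ _))) -0#≈0#)) (+-identityʳ _)))

  scaled-artinSchreier : ∀ b y → σ (b * y) - (b * b) * (b * y) ≈ σ b * (σ y - y)
  scaled-artinSchreier = solve 2 (λ b y → (b :* y) :* ((b :* y) :* ((b :* y) :* con 1₃)) :- (b :* b) :* (b :* y)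
                                     := (b :* (b :* (b :* con 1₃))) :* (y :* (y :* (y :* con 1₃)) :- y)) refl

  -- If A₁ = b² with b ≠ 0, the roots of X³ - A₁X - A₀ are the b y with
  -- σ y - y = A₀/b³.
  module SquareCase (A₁ A₀ b : Carrier) (A₁≈b² : A₁ ≈ b * b) (b≉0 : ¬ (b ≈ 0#)) where
    σb≉0 : ¬ (σ b ≈ 0#)
    σb≉0 = ^′-nonzero 3 b≉0

    artinSchreier⇒root : ∀ y → σ y - y ≈ A₀ / (b ^′ 3) → depressed A₁ A₀ (b * y) ≈ 0#
    artinSchreier⇒root y y-AS = begin
      (σ (b * y) - A₁ * (b * y)) - A₀        ≈⟨ +-congʳ (+-congˡ (-‿cong (*-congʳ A₁≈b²))) ⟩
      (σ (b * y) - (b * b) * (b * y)) - A₀   ≈⟨ +-congʳ (scaled-artinSchreier b y) ⟩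
      σ b * (σ y - y) - A₀                   ≈⟨ +-congʳ (trans (*-congˡ y-AS) (*-/-cancel A₀ σb≉0)) ⟩
      A₀ - A₀                                ≈⟨ -‿inverseʳ _ ⟩
      0#                                     ∎

    root⇒artinSchreier : ∀ z → depressed A₁ A₀ z ≈ 0# → σ (z * b ⁻¹) - z * b ⁻¹ ≈ A₀ / (b ^′ 3)
    root⇒artinSchreier z root = *-cancelʳ-nonzero σb≉0 (begin
      (σ y - y) * σ b                        ≈⟨ *-comm _ _ ⟩
      σ b * (σ y - y)                        ≈⟨ sym (scaled-artinSchreier b y) ⟩
      σ (b * y) - (b * b) * (b * y)          ≈⟨ +-cong (σ-cong by≈z) (-‿cong (*-cong (sym A₁≈b²) by≈z)) ⟩
      σ z - A₁ * z                           ≈⟨ x∙y⁻¹≈ε⇒x≈y _ _ root ⟩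
      A₀                                     ≈⟨ sym (*-/-cancel A₀ σb≉0) ⟩
      σ b * (A₀ / (b ^′ 3))                  ≈⟨ *-comm _ _ ⟩
      (A₀ / (b ^′ 3)) * σ b                  ∎)
      where
      y = z * b ⁻¹
      by≈z : b * y ≈ z
      by≈z = *-/-cancel z b≉0

  square-root-nonzero : ∀ {A₁ b} → A₁ ≈ b * b → ¬ (A₁ ≈ 0#) → ¬ (b ≈ 0#)
  square-root-nonzero A₁≈b² A₁≉0 b≈0 = A₁≉0 (trans A₁≈b² (trans (*-congʳ b≈0) (zeroˡ _)))

  -- if A₁ = b² and Tr(A₀/b³) ≠ 0, the depressed cubic has no root, since
  -- Artin–Schreier elements have trace 0
  square-trace⇒rootless : ∀ A₁ A₀ → ¬ (A₁ ≈ 0#) → Condition₁ A₁ A₀ → ∀ z → ¬ (depressed A₁ A₀ z ≈ 0#)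
  square-trace⇒rootless A₁ A₀ A₁≉0 (b , A₁≈b² , Tr≉0) z root =
    Tr≉0 (trans (Tr-cong (sym (root⇒artinSchreier z root))) (Tr-artinSchreier _))
    where open SquareCase A₁ A₀ b A₁≈b² (square-root-nonzero A₁≈b² A₁≉0)

  -- If A₁ is not a square, φ x = σ x - A₁x is injective (its kernel would
  -- contain a square root of A₁), hence bijective, and A₀ has a preimage.
  nonsquare⇒root : ∀ A₁ A₀ → (∀ d → ¬ (d * d ≈ A₁)) → Σ Carrier λ z → depressed A₁ A₀ z ≈ 0#
  nonsquare⇒root A₁ A₀ nonsquare = elem i , x≈y⇒x∙y⁻¹≈ε (index-injective φi≡A₀)
    where
    φ : Carrier → Carrier
    φ x = σ x - A₁ * x
    φ-injective : ∀ {x y} → φ x ≈ φ y → x ≈ y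
    φ-injective {x} {y} φx≈φy with (x - y) ≈? 0#
    ... | yes d≈0 = x∙y⁻¹≈ε⇒x≈y x y d≈0
    ... | no d≉0  = ⊥-elim (nonsquare d (x∙y⁻¹≈ε⇒x≈y _ _ (nonzero-cancelˡ d≉0 d[d²-A₁]≈0)))
      where
      d = x - y
      d[d²-A₁]≈0 : d * (d * d - A₁) ≈ 0#
      d[d²-A₁]≈0 = begin
        d * (d * d - A₁) ≈⟨ solve 3 (λ x y a → (x :- y) :* ((x :- y) :* (x :- y) :- a)
                              := (x :* (x :* (x :* con 1₃)) :- a :* x) :- (y :* (y :* (y :* con 1₃)) :- a :* y)) refl x y A₁ ⟩
        φ x - φ y        ≈⟨ x≈y⇒x∙y⁻¹≈ε φx≈φy ⟩
        0#               ∎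
    ψ : Fin (3 ^ s) → Fin (3 ^ s)
    ψ i = index (φ (elem i))
    preimage : Σ (Fin (3 ^ s)) λ i → ψ i ≡ index A₀
    preimage = injective⇒surjective ψ (λ eq → elem-injective (φ-injective (index-injective eq))) (index A₀)
    i = proj₁ preimage
    φi≡A₀ = proj₂ preimage

  -- If the depressed cubic is rootless, A₁ is a square (previous lemma) and
  -- Tr(A₀/b³) ≠ 0 (otherwise Hilbert 90 produces a root).
  rootless⇒square-trace : ∀ A₁ A₀ → ¬ (A₁ ≈ 0#) → (∀ z → ¬ (depressed A₁ A₀ z ≈ 0#)) → Condition₁ A₁ A₀
  rootless⇒square-trace A₁ A₀ A₁≉0 rootless with FinP.any? (λ i → (elem i * elem i) ≈? A₁)
  ... | yes (i , b²≈A₁) = elem i , sym b²≈A₁ , λ Tr≈0 →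
          rootless _ (artinSchreier⇒root _ (proj₂ (hilbert90 _ Tr≈0)))
    where open SquareCase A₁ A₀ (elem i) (sym b²≈A₁) (square-root-nonzero (sym b²≈A₁) A₁≉0)
  ... | no nonsquare = ⊥-elim (rootless _ (proj₂ (nonsquare⇒root A₁ A₀ no-root)))
    where
    no-root : ∀ d → ¬ (d * d ≈ A₁)
    no-root d d²≈A₁ = nonsquare (index d , trans (*-cong (elem-index d) (elem-index d)) d²≈A₁)

  -- An identity that holds modulo t - 1 holds once t ≈ 1; this lets the
  -- solver verify identities involving inverses such as a₂ ⁻¹ · a₂ = 1.
  modulo-t-1 : ∀ {X Y t} Q → t ≈ 1# → X ≈ Y + (t - 1#) * Q → X ≈ Y
  modulo-t-1 {X} {Y} {t} Q t≈1 p =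
    trans p (trans (+-congˡ (trans (*-congʳ (trans (+-congʳ t≈1) (-‿inverseʳ 1#))) (zeroˡ Q))) (+-identityʳ Y))

  -- With v = a₁/a₂ and f(v) ≠ 0, the roots r of f correspond to the roots
  -- Z = 1/(r - v) of X³ - B₁X - B₀, where B₁ = a₂/f(v), B₀ = -1/f(v).
  module Reduction (a₂ a₁ a₀ : Carrier) (a₂≉0 : ¬ (a₂ ≈ 0#)) where
    v fv D L B₁ B₀ : Carrier
    v  = a₁ * a₂ ⁻¹
    fv = cubicValue a₂ a₁ a₀ v
    D  = ((a₂ * a₂) * (a₁ * a₁)) + ((a₁ ^′ 3) + (- (a₀ * (a₂ ^′ 3))))
    L  = (a₂ ^′ 4) / D
    B₁ = a₂ * fv ⁻¹
    B₀ = - (fv ⁻¹)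

    a₂⁻¹a₂≈1 : a₂ ⁻¹ * a₂ ≈ 1#
    a₂⁻¹a₂≈1 = inverseˡ a₂ a₂≉0

    fv·a₂³≈D : fv * (a₂ ^′ 3) ≈ D
    fv·a₂³≈D = modulo-t-1
      (a₁ * a₁ * a₁ * ((u * a₂) * (u * a₂) + (u * a₂) + 1#) - a₁ * a₁ * a₂ * a₂ * ((u * a₂) + 1#) - a₁ * a₁ * a₂ * a₂)
      a₂⁻¹a₂≈1
      (solve 4 (λ a₂ a₁ a₀ u →
         ((((a₁ :* u) :* ((a₁ :* u) :* ((a₁ :* u) :* con 1₃)) :- a₂ :* ((a₁ :* u) :* (a₁ :* u))) :- a₁ :* (a₁ :* u)) :- a₀)
           :* (a₂ :* (a₂ :* (a₂ :* con 1₃)))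
         := (((a₂ :* a₂) :* (a₁ :* a₁)) :+ ((a₁ :* (a₁ :* (a₁ :* con 1₃))) :+ (:- (a₀ :* (a₂ :* (a₂ :* (a₂ :* con 1₃)))))))
            :+ ((u :* a₂) :- con 1₃) :* (a₁ :* a₁ :* a₁ :* ((u :* a₂) :* (u :* a₂) :+ (u :* a₂) :+ con 1₃)
                                         :- a₁ :* a₁ :* a₂ :* a₂ :* ((u :* a₂) :+ con 1₃) :- a₁ :* a₁ :* a₂ :* a₂))
        refl a₂ a₁ a₀ u)
      where u = a₂ ⁻¹

    -- expansion of f around v: (v + d)³ = v³ + d³ in characteristic 3, and
    -- the linear term (a₂v - a₁)d vanishes by the choice of v
    f[v+d] : ∀ d → cubicValue a₂ a₁ a₀ (v + d) ≈ (fv - a₂ * (d * d)) + σ d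
    f[v+d] d = begin
      cubicValue a₂ a₁ a₀ (v + d)
        ≈⟨ solve 5 (λ a₂ a₁ a₀ v d →
             (((v :+ d) :* ((v :+ d) :* ((v :+ d) :* con 1₃)) :- a₂ :* ((v :+ d) :* (v :+ d))) :- a₁ :* (v :+ d)) :- a₀
             := ((((v :* (v :* (v :* con 1₃)) :- a₂ :* (v :* v)) :- a₁ :* v) :- a₀) :- a₂ :* (d :* d))
                :+ d :* (d :* (d :* con 1₃)) :+ (a₂ :* v :- a₁) :* d)
           refl a₂ a₁ a₀ v d ⟩
      ((fv - a₂ * (d * d)) + σ d) + (a₂ * v - a₁) * d ≈⟨ +-congˡ (trans (*-congʳ a₂v-a₁≈0) (zeroˡ d)) ⟩
      ((fv - a₂ * (d * d)) + σ d) + 0#                 ≈⟨ +-identityʳ _ ⟩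
      (fv - a₂ * (d * d)) + σ d                        ∎
      where
      a₂v-a₁≈0 : a₂ * v - a₁ ≈ 0#
      a₂v-a₁≈0 = modulo-t-1 a₁ a₂⁻¹a₂≈1
        (solve 3 (λ a₂ a₁ u → a₂ :* (a₁ :* u) :- a₁ := con 0₃ :+ ((u :* a₂) :- con 1₃) :* a₁) refl a₂ a₁ (a₂ ⁻¹))

    module NonzeroValue (fv≉0 : ¬ (fv ≈ 0#)) where
      fv⁻¹fv≈1 : fv ⁻¹ * fv ≈ 1#
      fv⁻¹fv≈1 = inverseˡ fv fv≉0

      substitution : ∀ z d → z * d ≈ 1# → cubicValue a₂ a₁ a₀ (v + d) ≈ σ d * (fv * depressed B₁ B₀ z)
      substitution z d zd≈1 = begin
        cubicValue a₂ a₁ a₀ (v + d) ≈⟨ f[v+d] d ⟩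
        (fv - a₂ * (d * d)) + σ d
          ≈⟨ sym (modulo-t-1 (fv * ((z * d) * (z * d) + (z * d) + 1#) - a₂ * (d * d)) zd≈1
               (solve 4 (λ f a₂ z d → d :* (d :* (d :* con 1₃)) :* ((f :* (z :* (z :* (z :* con 1₃))) :- a₂ :* z) :+ con 1₃)
                  := ((f :- a₂ :* (d :* d)) :+ d :* (d :* (d :* con 1₃)))
                     :+ ((z :* d) :- con 1₃) :* (f :* ((z :* d) :* (z :* d) :+ (z :* d) :+ con 1₃) :- a₂ :* (d :* d)))
                 refl fv a₂ z d)) ⟩
        σ d * ((fv * σ z - a₂ * z) + 1#) ≈⟨ *-congˡ (sym (fv·depressed z)) ⟩
        σ d * (fv * depressed B₁ B₀ z)   ∎
        where
        fv·depressed : ∀ z → fv * depressed B₁ B₀ z ≈ (fv * σ z - a₂ * z) + 1#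
        fv·depressed z = modulo-t-1 (1# - a₂ * z) fv⁻¹fv≈1
          (solve 4 (λ f k a₂ z → f :* ((z :* (z :* (z :* con 1₃)) :- (a₂ :* k) :* z) :- (:- k))
                      := ((f :* (z :* (z :* (z :* con 1₃))) :- a₂ :* z) :+ con 1₃) :+ ((k :* f) :- con 1₃) :* (con 1₃ :- a₂ :* z))
             refl fv (fv ⁻¹) a₂ z)

      root⇒depressed-root : ∀ r → cubicValue a₂ a₁ a₀ r ≈ 0# → Σ Carrier λ z → depressed B₁ B₀ z ≈ 0#
      root⇒depressed-root r root = d ⁻¹ , nonzero-cancelˡ fv≉0 (nonzero-cancelˡ (^′-nonzero 3 d≉0) (begin
        σ d * (fv * depressed B₁ B₀ (d ⁻¹)) ≈⟨ sym (substitution (d ⁻¹) d (inverseˡ d d≉0)) ⟩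
        cubicValue a₂ a₁ a₀ (v + d)         ≈⟨ cubicValue-cong a₂ a₁ a₀ v+d≈r ⟩
        cubicValue a₂ a₁ a₀ r               ≈⟨ root ⟩
        0#                                  ∎))
        where
        d = r - v
        v+d≈r : v + d ≈ r
        v+d≈r = solve 2 (λ v r → v :+ (r :- v) := r) refl v r
        d≉0 : ¬ (d ≈ 0#)
        d≉0 d≈0 = fv≉0 (trans (cubicValue-cong a₂ a₁ a₀ (sym (x∙y⁻¹≈ε⇒x≈y r v d≈0))) root)

      depressed-root⇒root : ∀ z → depressed B₁ B₀ z ≈ 0# → cubicValue a₂ a₁ a₀ (v + z ⁻¹) ≈ 0#
      depressed-root⇒root z root =
        trans (substitution z (z ⁻¹) (inverseʳ z z≉0)) (trans (*-congˡ (trans (*-congˡ root) (zeroʳ fv))) (zeroʳ _))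
        where
        -- 0 is not a root, as the depressed cubic takes the value 1/f(v) there
        z≉0 : ¬ (z ≈ 0#)
        z≉0 z≈0 = ⁻¹-nonzero fv fv≉0 (trans (sym value-at-0) (trans (+-congʳ (+-cong (σ-cong (sym z≈0)) (-‿cong (*-congˡ (sym z≈0))))) root))
          where
          value-at-0 : depressed B₁ B₀ 0# ≈ fv ⁻¹
          value-at-0 = solve 2 (λ a k → ((con 0₃ :* (con 0₃ :* (con 0₃ :* con 1₃)) :- (a :* k) :* con 0₃) :- (:- k)) := k) refl a₂ (fv ⁻¹)

      B₁≉0 : ¬ (B₁ ≈ 0#)
      B₁≉0 = *-nonzero a₂≉0 (⁻¹-nonzero fv fv≉0)

      D≉0 : ¬ (D ≈ 0#)
      D≉0 D≈0 = *-nonzero fv≉0 (^′-nonzero 3 a₂≉0) (trans fv·a₂³≈D D≈0)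

      L≈B₁ : L ≈ B₁
      L≈B₁ = *-cancelʳ-nonzero D≉0 (begin
        L * D        ≈⟨ modulo-t-1 (a₂ ^′ 4) (inverseˡ D D≉0)
                          (solve 3 (λ x k d → (x :* k) :* d := x :+ (k :* d :- con 1₃) :* x) refl (a₂ ^′ 4) (D ⁻¹) D) ⟩
        a₂ ^′ 4      ≈⟨ sym (modulo-t-1 (a₂ * (a₂ ^′ 3)) fv⁻¹fv≈1
                          (solve 3 (λ a k f → (a :* k) :* (f :* (a :* (a :* (a :* con 1₃))))
                                      := a :* (a :* (a :* (a :* con 1₃))) :+ ((k :* f) :- con 1₃) :* (a :* (a :* (a :* (a :* con 1₃)))))
                             refl a₂ (fv ⁻¹) fv)) ⟩
        B₁ * (fv * (a₂ ^′ 3)) ≈⟨ *-congˡ fv·a₂³≈D ⟩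
        B₁ * D       ∎)

      B₀/b³ : ∀ b → b * b ≈ B₁ → ¬ (b ≈ 0#) → B₀ / (b ^′ 3) ≈ - (1# / (a₂ * b))
      B₀/b³ b b²≈B₁ b≉0 = *-cancelʳ-nonzero (*-nonzero fv≉0 σb≉0) (begin
        B₀ / (b ^′ 3) * (fv * σ b)
          ≈⟨ solve 4 (λ k w f β → ((:- k) :* w) :* (f :* β) := :- ((k :* f) :* (w :* β))) refl (fv ⁻¹) ((b ^′ 3) ⁻¹) fv (σ b) ⟩
        - ((fv ⁻¹ * fv) * ((b ^′ 3) ⁻¹ * σ b))      ≈⟨ -‿cong (*-cong fv⁻¹fv≈1 (inverseˡ (σ b) σb≉0)) ⟩
        - (1# * 1#)                                  ≈⟨ sym (-‿cong (*-cong (inverseˡ (a₂ * b) (*-nonzero a₂≉0 b≉0)) fv⁻¹fv≈1)) ⟩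
        - (((a₂ * b) ⁻¹ * (a₂ * b)) * (fv ⁻¹ * fv))
          ≈⟨ solve 5 (λ m a b k f → :- ((m :* (a :* b)) :* (k :* f)) := :- ((m :* f :* b) :* (a :* k))) refl ((a₂ * b) ⁻¹) a₂ b (fv ⁻¹) fv ⟩
        - (((a₂ * b) ⁻¹ * fv * b) * B₁)             ≈⟨ -‿cong (*-congˡ (sym b²≈B₁)) ⟩
        - (((a₂ * b) ⁻¹ * fv * b) * (b * b))
          ≈⟨ solve 3 (λ m f b → :- ((m :* f :* b) :* (b :* b)) := (:- (con 1₃ :* m)) :* (f :* (b :* (b :* (b :* con 1₃))))) refl ((a₂ * b) ⁻¹) fv b ⟩
        - (1# / (a₂ * b)) * (fv * σ b)              ∎)
        where
        σb≉0 : ¬ (σ b ≈ 0#)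
        σb≉0 = ^′-nonzero 3 b≉0

  case₁ : ∀ a₂ a₁ a₀ → a₂ ≈ 0# → ¬ (a₁ ≈ 0#) →
    (Irreducible (cubic a₂ a₁ a₀) → Condition₁ a₁ a₀) × (Condition₁ a₁ a₀ → Irreducible (cubic a₂ a₁ a₀))
  case₁ a₂ a₁ a₀ a₂≈0 a₁≉0 =
    (λ irreducible → rootless⇒square-trace a₁ a₀ a₁≉0 (λ z root →
       irreducible⇒rootless a₂ a₁ a₀ irreducible z (trans (cubicValue-a₂≈0 a₂ a₁ a₀ z a₂≈0) root))) ,
    (λ condition → rootless⇒irreducible a₂ a₁ a₀ (λ r root →
       square-trace⇒rootless a₁ a₀ a₁≉0 condition r (trans (sym (cubicValue-a₂≈0 a₂ a₁ a₀ r a₂≈0)) root)))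

  Condition₂ : Carrier → Carrier → Carrier → Set (c ⊔ ℓ)
  Condition₂ a₂ a₁ a₀ = Σ Carrier λ b →
    ((a₂ ^′ 4) / (((a₂ * a₂) * (a₁ * a₁)) + ((a₁ ^′ 3) + (- (a₀ * (a₂ ^′ 3))))) ≈ (b * b))
    × ¬ (Tr s (1# / (a₂ * b)) ≈ 0#)

  case₂ : ∀ a₂ a₁ a₀ → ¬ (a₂ ≈ 0#) →
    (Irreducible (cubic a₂ a₁ a₀) → Condition₂ a₂ a₁ a₀) × (Condition₂ a₂ a₁ a₀ → Irreducible (cubic a₂ a₁ a₀))
  case₂ a₂ a₁ a₀ a₂≉0 = irreducible⇒condition , condition⇒irreducible
    where
    open Reduction a₂ a₁ a₀ a₂≉0

    -- f rootless ⇒ the depressed cubic is rootless ⇒ B₁ = b², Tr(B₀/b³) ≠ 0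
    irreducible⇒condition : Irreducible (cubic a₂ a₁ a₀) → Condition₂ a₂ a₁ a₀
    irreducible⇒condition irreducible = b , trans L≈B₁ B₁≈b² , Tr≉0
      where
      rootless = irreducible⇒rootless a₂ a₁ a₀ irreducible
      open NonzeroValue (rootless v)
      condition : Condition₁ B₁ B₀
      condition = rootless⇒square-trace B₁ B₀ B₁≉0 (λ z root → rootless _ (depressed-root⇒root z root))
      b = proj₁ condition
      B₁≈b² = proj₁ (proj₂ condition)
      Tr≉0 : ¬ (Tr s (1# / (a₂ * b)) ≈ 0#)
      Tr≉0 Tr≈0 = proj₂ (proj₂ condition) (begin
        Tr s (B₀ / (b ^′ 3))      ≈⟨ Tr-cong (B₀/b³ b (sym B₁≈b²) (square-root-nonzero B₁≈b² B₁≉0)) ⟩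
        Tr s (- (1# / (a₂ * b)))  ≈⟨ Tr-- _ ⟩
        - Tr s (1# / (a₂ * b))    ≈⟨ -‿cong Tr≈0 ⟩
        - 0#                      ≈⟨ -0#≈0# ⟩
        0#                        ∎)

    -- the condition forces b ≠ 0, D ≠ 0, f(v) ≠ 0 and transfers to B₁, B₀
    condition⇒irreducible : Condition₂ a₂ a₁ a₀ → Irreducible (cubic a₂ a₁ a₀)
    condition⇒irreducible (b , L≈b² , Tr≉0) = rootless⇒irreducible a₂ a₁ a₀ (λ r root →
        let (z , z-root) = root⇒depressed-root r root in
        square-trace⇒rootless B₁ B₀ B₁≉0 (b , B₁≈b² , Tr[B₀/b³]≉0) z z-root)
      where
      b≉0 : ¬ (b ≈ 0#)
      b≉0 b≈0 = Tr≉0 (trans (Tr-cong (trans (*-congˡ (trans (⁻¹-cong (trans (*-congˡ b≈0) (zeroʳ a₂))) 0⁻¹≈0))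
                                            (zeroʳ 1#)))
                            Tr-0)
      D≉0 : ¬ (D ≈ 0#)
      D≉0 D≈0 = b≉0 (nonzero-cancelˡ b≉0 (trans (sym L≈b²) (trans (*-congˡ (trans (⁻¹-cong D≈0) 0⁻¹≈0)) (zeroʳ _))))
      fv≉0 : ¬ (fv ≈ 0#)
      fv≉0 fv≈0 = D≉0 (trans (sym fv·a₂³≈D) (trans (*-congʳ fv≈0) (zeroˡ _)))
      open NonzeroValue fv≉0
      B₁≈b² : B₁ ≈ b * b
      B₁≈b² = trans (sym L≈B₁) L≈b²
      Tr[B₀/b³]≉0 : ¬ (Tr s (B₀ / (b ^′ 3)) ≈ 0#)
      Tr[B₀/b³]≉0 Tr≈0 = -‿nonzero _ Tr≉0 (trans (sym (Tr-- _)) (trans (Tr-cong (sym (B₀/b³ b (sym B₁≈b²) b≉0))) Tr≈0))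

lemma4p2 : ∀ {c ℓ : Level} (s : ℕ) (F : FiniteField c ℓ (3 ^ s)) →
    let open FiniteField F in
    ∀ (a₂ a₁ a₀ : Carrier) →
      -- case (1): a₂ = 0, a₁ ≠ 0
      ((a₂ ≈ 0#) → ¬ (a₁ ≈ 0#) →
        (Irreducible (cubic a₂ a₁ a₀) →
           Σ Carrier λ b → (a₁ ≈ (b * b)) × ¬ (Tr s (a₀ / (b ^′ 3)) ≈ 0#))
        × ((Σ Carrier λ b → (a₁ ≈ (b * b)) × ¬ (Tr s (a₀ / (b ^′ 3)) ≈ 0#)) →
           Irreducible (cubic a₂ a₁ a₀)))
      ×
      -- case (2): a₂ ≠ 0
      (¬ (a₂ ≈ 0#) →
        (Irreducible (cubic a₂ a₁ a₀) →
           Σ Carrier λ b →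
             ((a₂ ^′ 4) / (((a₂ * a₂) * (a₁ * a₁)) + ((a₁ ^′ 3) + (- (a₀ * (a₂ ^′ 3))))) ≈ (b * b))
             × ¬ (Tr s (1# / (a₂ * b)) ≈ 0#))
        × ((Σ Carrier λ b →
             ((a₂ ^′ 4) / (((a₂ * a₂) * (a₁ * a₁)) + ((a₁ ^′ 3) + (- (a₀ * (a₂ ^′ 3))))) ≈ (b * b))
             × ¬ (Tr s (1# / (a₂ * b)) ≈ 0#)) →
           Irreducible (cubic a₂ a₁ a₀)))
lemma4p2 s F a₂ a₁ a₀ = case₁ a₂ a₁ a₀ , case₂ a₂ a₁ a₀
  where open Char3 s F
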